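{- Let $P$ be a protocol that solves the Ordered Response problem $\mathsf{OR}\langle e_{\mathtt t},\alpha_1,\ldots,\alpha_k\rangle$ in $\gamma^{\max}$. If $e_{\mathtt t}$ occurs at $(i_0,t)$ in a run $r\in\mathcal R(P,\gamma^{\max})$ and the response $\alpha_h$ occurs at $(i_h,t_h)$ in $r$, then $(i_0,t)\rightsquigarrow(i_h,t_h)$ in $r$.
   Context: Model: a finite set of processes communicates over a directed network; each channel $i\to j$ has a known integer upper bound $b_{ij}\ge 1$ on transmission time. Time is global and discrete, and every local state contains the current time. In the context $\gamma^{\max}$, a message sent on $i\to j$ at time $s$ is received at a nondeterministically chosen time in $[s+1,s+b_{ij}]$; processes may receive external inputs, chosen nondeterministically and independently of the past. A protocol prescribes each process's actions as a function of its local state; $\mathcal R(P,\gamma^{\max})$ is the set of all runs of $P$ in this context. A node $(i,t)$ denotes process $i$ at time $t$. Syncausality $\rightsquigarrow$ in a run $r$: the smallest relation on nodes such that (1) $(i,t)\rightsquigarrow(i,t')$ whenever $t\le t'$; (2) $(i,t)\rightsquigarrow(j,t')$ if some message sent at $(i,t)$ is received at $(j,t')$; (3) $(i,t)\rightsquigarrow(j,t+b_{ij})$ if $j$ is a neighbour of $i$ and $i$ sends no message to $j$ at time $t$; (4) it is transitive. Ordered Response $\mathsf{OR}\langle e_{\mathtt t},\alpha_1,\ldots,\alpha_k\rangle$: $e_{\mathtt t}$ is an external input (trigger) at process $i_0$, occurring at most once per run; each response $\alpha_h$ is the performance of an action $a_h$ by process $i_h$. $P$ solves it if in every run the responses are performed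 only if $e_{\mathtt t}$ occurs, are all performed when $e_{\mathtt t}$ occurs, and are performed in order: if $e_{\mathtt t}$ occurs at time $t$ and $\alpha_h$ at time $t_h$, then $t\le t_1\le\cdots\le t_k$. -}

module Defs where

open import Data.Nat using (ℕ; zero; suc; _+_; _≤_; _≟_)
open import Data.Fin using (Fin; toℕ)
open import Data.Bool using (Bool; true)
open import Data.Maybe using (Maybe; just; nothing)
open import Data.List using (List; []; _∷_; _++_; concatMap; upTo; allFin; take)
open import Data.List.Membership.Propositional using (_∈_)
open import Data.Product using (_×_; _,_; proj₁; proj₂; ∃)
open import Relation.Nullary using (yes; no)
open import Relation.Binary.PropositionalEquality using (_≡_)

-- A system: finitely many processes (Fin n), a directed network with
-- integer upper bounds on transmission times, and arbitrary types of
-- external inputs, message contents and actions.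
record System : Set₁ where
  field
    n      : ℕ
    Ext    : Set
    Msg    : Set
    Act    : Set
    edge   : Fin n → Fin n → Bool
    bound  : Fin n → Fin n → ℕ
    bound≥1 : ∀ i j → edge i j ≡ true → 1 ≤ bound i j

module Model (S : System) where
  open System S public

  Node : Set
  Node = Fin n × ℕ

  -- What a process observes at one time step: the external inputs it
  -- receives and the messages (sender, content) delivered to it.
  Round : Set
  Round = List Ext × List (Fin n × Msg)

  -- Local state = complete history of rounds 0..t (length t+1, so it
  -- contains the current time).
  History : Set
  History = List Round

  Protocol : Set
  Protocol = Fin n → History → (Fin n → Maybe Msg) × List Act

  -- Nondeterministic choices of the environment in γ^max: external inputs
  -- at every node, and delivery delays for every channel and sending time.
  record Env : Set where
    field
      ext      : Fin n → ℕ → List Ext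
      delay    : Fin n → Fin n → ℕ → ℕ
      delay-ok : ∀ i j s → edge i j ≡ true → (1 ≤ delay i j s) × (delay i j s ≤ bound i j)
  open Env public

  -- messages delivered to i at time t', given the histories G at time t'-1
  -- (local state of j at time s is the prefix of length s+1).
  recv : Protocol → Env → (Fin n → History) → ℕ → Fin n → List (Fin n × Msg)
  recv P E G t' i = concatMap fromSender (allFin n)
    where
      fromSender : Fin n → List (Fin n × Msg)
      fromSender j = concatMap at (upTo t')
        where
          at : ℕ → List (Fin n × Msg)
          at s with edge j i | s + delay E j i s ≟ t' | proj₁ (P j (take (suc s) (G j))) i
          ... | true | yes _ | just m = (j , m) ∷ []
          ... | _    | _     | _      = []

  hist : Protocol → Env → ℕ → Fin n → History
  hist P E zero i = (ext E i zero , []) ∷ []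
  hist P E (suc t) i = hist P E t i ++ ((ext E i (suc t) , recv P E (hist P E t) (suc t) i) ∷ [])

  out : Protocol → Env → Fin n → ℕ → (Fin n → Maybe Msg) × List Act
  out P E i t = P i (hist P E t i)

  -- i sends message m to j at time t (received at time t + delay E i j t)
  Sends : Protocol → Env → Fin n → Fin n → ℕ → Msg → Set
  Sends P E i j t m = (edge i j ≡ true) × (proj₁ (out P E i t) j ≡ just m)

  Performs : Protocol → Env → Fin n × Act → ℕ → Set
  Performs P E (i , a) t = a ∈ proj₂ (out P E i t)

  Occurs : Env → Fin n × Ext → ℕ → Set
  Occurs E (i0 , e) t = e ∈ ext E i0 t

  -- runs of R(P, γ^max) for the trigger: it occurs at most once
  AtMostOnce : Env → Fin n × Ext → Set
  AtMostOnce E tr = ∀ t t' → Occurs E tr t → Occurs E tr t' → t ≡ t'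

  data Syn (P : Protocol) (E : Env) : Node → Node → Set where
    loc    : ∀ {i t t'} → t ≤ t' → Syn P E (i , t) (i , t')
    msg    : ∀ {i j t m} → Sends P E i j t m → Syn P E (i , t) (j , t + delay E i j t)
    silent : ∀ {i j t} → edge i j ≡ true → proj₁ (out P E i t) j ≡ nothing →
             Syn P E (i , t) (j , t + bound i j)
    trans  : ∀ {x y z} → Syn P E x y → Syn P E y z → Syn P E x z

  -- P solves OR⟨e_t, α_1, …, α_k⟩ in γ^max; tr = (i0 , e_t), α h = (i_h , a_h)
  SolvesOR : Protocol → Fin n × Ext → (k : ℕ) → (Fin k → Fin n × Act) → Set
  SolvesOR P tr k α =
    ∀ (E : Env) → AtMostOnce E tr →
      (∀ h t' → Performs P E (α h) t' → ∃ λ t → Occurs E tr t)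
    × (∀ t → Occurs E tr t → ∀ h → ∃ λ t' → Performs P E (α h) t')
    × (∀ t (ts : Fin k → ℕ) → Occurs E tr t → (∀ h → Performs P E (α h) (ts h)) →
         (∀ h → t ≤ ts h) × (∀ h h' → toℕ h ≤ toℕ h' → ts h ≤ ts h'))

module Submission where

-- Proof (by indistinguishability).  Let C be the syncausal cone of (i0 , t):
-- the nodes reachable from it by local steps, message deliveries and
-- silences.  Build a second environment E' of γ^max that agrees with E
-- outside C, while inside C it supplies no external inputs and delays
-- every transmission maximally.  Every send from a node of C then arrives
-- inside C in both runs, so nothing in C can influence a node outside C:
-- by induction on time, nodes outside C have the same local state in both
-- runs.  In E' the trigger never occurs (inside C it is removed, outside C
-- it would occur at (i0 , t) ∈ C).  Were (i_h , t_h) outside C, it would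
-- perform α_h in E' as well, contradicting that P solves OR.
--
-- Since E' must branch on membership in C, the cone is computed as a
-- Boolean table, row by row in time.

open import Defs
open import Data.Nat using (ℕ; zero; suc; _+_; _≤_; _<_; _≤ᵇ_; _≡ᵇ_; _≟_; _≤′_; ≤′-refl; ≤′-step; s≤s; z≤n)
open import Data.Nat.Properties
  using (≤-refl; ≤-reflexive; ≤-trans; n≤1+n; n<1+n; <-irrefl; +-comm; m<m+n; +-monoʳ-≤;
         m≤n⇒m<n∨m≡n; ≤-pred; ≤⇒≤′; ≤ᵇ⇒≤; ≤⇒≤ᵇ; ≡ᵇ⇒≡; ≡⇒≡ᵇ)
open import Data.Nat.Induction using (<-wellFounded)
open import Induction.WellFounded using (Acc; acc)
open import Data.Fin using (Fin) renaming (_≟_ to _≟-Fin_)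
open import Data.Bool using (Bool; true; false; _∧_; _∨_; if_then_else_; T; T?)
open import Data.Bool.Properties using (T-∨; T-∧; T-≡)
open import Data.Maybe using (just; nothing; maybe′)
open import Data.List using (List; []; _∷_; _++_; length; take; concat; upTo; allFin)
open import Data.Bool.ListAction using (any)
open import Data.List.Properties using (length-++; take-all; map-cong; map-cong-local)
open import Data.List.Relation.Unary.All.Properties using (applyUpTo⁺₁)
open import Data.List.Relation.Unary.Any.Properties using (any⁺; any⁻)
open import Data.List.Membership.Propositional using (_∈_; find; lose)
open import Data.List.Membership.Propositional.Properties using (∈-allFin; ∈-upTo⁺; ∈-upTo⁻)
open import Data.List.Relation.Unary.Any using (satisfied)
open import Data.Product using (_×_; _,_; proj₁; proj₂)
open import Data.Sum using (inj₁; inj₂)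
open import Data.Empty using (⊥-elim)
open import Function using (id)
open import Function.Bundles using (Equivalence)
open import Relation.Nullary using (¬_; yes; no; isYes)
open import Relation.Binary.PropositionalEquality
  using (_≡_; _≢_; refl; sym; cong; cong₂; subst; module ≡-Reasoning)
  renaming (trans to ≡-trans)

open Equivalence using (to; from)

if-true : ∀ {A : Set} {b} {x y : A} → T b → (if b then x else y) ≡ x
if-true {b = true} _ = refl

if-false : ∀ {A : Set} {b} {x y : A} → ¬ T b → (if b then x else y) ≡ y
if-false {b = true}  ¬b = ⊥-elim (¬b _)
if-false {b = false} _  = refl

take-++ˡ : ∀ {A : Set} m (xs ys : List A) → m ≤ length xs → take m (xs ++ ys) ≡ take m xs
take-++ˡ zero    xs       ys _         = refl
take-++ˡ (suc m) (x ∷ xs) ys (s≤s m≤) = cong (x ∷_) (take-++ˡ m xs ys m≤)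

module Causality (S : System) where
  open Model S

  hist-length : ∀ P E s i → length (hist P E s i) ≡ suc s
  hist-length P E zero    i = refl
  hist-length P E (suc s) i = begin
    length (hist P E s i ++ _)  ≡⟨ length-++ (hist P E s i) ⟩
    length (hist P E s i) + 1   ≡⟨ cong (_+ 1) (hist-length P E s i) ⟩
    suc s + 1                   ≡⟨ +-comm (suc s) 1 ⟩
    suc (suc s)                 ∎
    where open ≡-Reasoning

  hist-prefix : ∀ P E {s' s} i → s' ≤ s → take (suc s') (hist P E s i) ≡ hist P E s' i
  hist-prefix P E {s = zero}  i z≤n = refl
  hist-prefix P E {s = suc s} i s'≤ with m≤n⇒m<n∨m≡n s'≤
  ... | inj₂ refl = take-all _ _ (≤-reflexive (hist-length P E (suc s) i))
  ... | inj₁ (s≤s s'≤s) =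
    ≡-trans (take-++ˡ _ (hist P E s i) _ (≤-trans (s≤s s'≤s) (≤-reflexive (sym (hist-length P E s i)))))
            (hist-prefix P E i s'≤s)

  MissesAt : Protocol → Env → (Fin n → History) → Fin n → Fin n → ℕ → ℕ → Set
  MissesAt P E G j i t' s =
    ∀ {m} → proj₁ (P j (take (suc s) (G j))) i ≡ just m → s + delay E j i s ≢ t'

  data SendsAlike (P : Protocol) (E E' : Env) (G G' : Fin n → History)
                  (j i : Fin n) (t' s : ℕ) : Set where
    same   : s + delay E j i s ≡ s + delay E' j i s →
             proj₁ (P j (take (suc s) (G j))) i ≡ proj₁ (P j (take (suc s) (G' j))) i →
             SendsAlike P E E' G G' j i t' s
    missed : MissesAt P E G j i t' s → MissesAt P E' G' j i t' s →
             SendsAlike P E E' G G' j i t' s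

  recv-cong : ∀ P E E' G G' t' i →
    (∀ j s → s < t' → edge j i ≡ true → SendsAlike P E E' G G' j i t' s) →
    recv P E G t' i ≡ recv P E' G' t' i
  recv-cong P E E' G G' t' i alike = receptions-agree
    where
    -- the entry of recv for sender j and sending time s; its type is an
    -- instance of a function local to recv, so it is left to unification
    entry : ∀ j {s} → s < t' → _

    receptions-agree : recv P E G t' i ≡ recv P E' G' t' i
    receptions-agree =
      cong concat (map-cong (λ j → cong concat (map-cong-local (applyUpTo⁺₁ id t' (entry j)))) (allFin n))

    entry j {s} s<t' with edge j i in e
    ... | false = refl
    ... | true with alike j s s<t' e
    entry j {s} s<t' | true | same arrives sends
            with s + delay E j i s ≟ t' | s + delay E' j i s ≟ t'
               | proj₁ (P j (take (suc s) (G j))) i | proj₁ (P j (take (suc s) (G' j))) i | sends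
    ...     | yes _   | yes _    | just _  | just _  | refl = refl
    ...     | yes _   | yes _    | nothing | nothing | _    = refl
    ...     | yes _   | yes _    | just _  | nothing | ()
    ...     | yes _   | yes _    | nothing | just _  | ()
    ...     | no _    | no _     | _       | _       | _    = refl
    ...     | yes arr | no ¬arr' | _       | _       | _    = ⊥-elim (¬arr' (≡-trans (sym arrives) arr))
    ...     | no ¬arr | yes arr' | _       | _       | _    = ⊥-elim (¬arr (≡-trans arrives arr'))
    entry j {s} s<t' | true | missed miss miss'
            with s + delay E j i s ≟ t' | proj₁ (P j (take (suc s) (G j))) i
               | s + delay E' j i s ≟ t' | proj₁ (P j (take (suc s) (G' j))) i
    ...     | yes arr | just _  | _       | _       = ⊥-elim (miss refl arr)
    ...     | _       | _       | yes arr | just _  = ⊥-elim (miss' refl arr)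
    ...     | yes _   | nothing | yes _   | nothing = refl
    ...     | yes _   | nothing | no _    | _       = refl
    ...     | no _    | _       | yes _   | nothing = refl
    ...     | no _    | _       | no _    | _       = refl

  -- The time at which j's send to i at time s takes effect at i: the
  -- delivery time of the message, or the deadline b_ji if j stays silent.
  arrival : Protocol → Env → Fin n → Fin n → ℕ → ℕ
  arrival P E j i s = maybe′ (λ _ → s + delay E j i s) (s + bound j i) (proj₁ (out P E j s) i)

  arrival-syn : ∀ P E {j i s} → edge j i ≡ true → Syn P E (j , s) (i , arrival P E j i s)
  arrival-syn P E {j} {i} {s} e with proj₁ (out P E j s) i in sent
  ... | just _  = msg (e , sent)
  ... | nothing = silent e sent

  arrival-later : ∀ P E {j i s} → edge j i ≡ true → s < arrival P E j i s
  arrival-later P E {j} {i} {s} e with proj₁ (out P E j s) i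
  ... | just _  = m<m+n s (proj₁ (delay-ok E j i s e))
  ... | nothing = m<m+n s (bound≥1 j i e)

  arrival-bounded : ∀ P E {j i s} → edge j i ≡ true → arrival P E j i s ≤ s + bound j i
  arrival-bounded P E {j} {i} {s} e with proj₁ (out P E j s) i
  ... | just _  = +-monoʳ-≤ s (proj₂ (delay-ok E j i s e))
  ... | nothing = ≤-refl

  arrival-sent : ∀ P E {j i s m} → proj₁ (out P E j s) i ≡ just m → arrival P E j i s ≡ s + delay E j i s
  arrival-sent P E sent = cong (maybe′ _ _) sent

  module Cone (P : Protocol) (E : Env) (i0 : Fin n) (t : ℕ) where

    origin : Fin n → ℕ → Bool
    origin j s = isYes (j ≟-Fin i0) ∧ (t ≤ᵇ s)

    feeds : (ℕ → Fin n → Bool) → Fin n → ℕ → Fin n → ℕ → Bool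
    feeds row j a j' s' = row s' j' ∧ (edge j' j ∧ (arrival P E j' j s' ≡ᵇ a))

    fedBy : (ℕ → Fin n → Bool) → ℕ → Fin n → Bool
    fedBy row s j = any (λ j' → any (feeds row j (suc s) j') (upTo (suc s))) (allFin n)

    nextRow : (ℕ → Fin n → Bool) → ℕ → Fin n → Bool
    nextRow row s j = origin j (suc s) ∨ (row s j ∨ fedBy row s j)

    -- rows s s' is row s' of the cone, for every s' ≤ s
    rows : ℕ → ℕ → Fin n → Bool
    rows zero    s' j = origin j zero
    rows (suc s) s' j = if s' ≤ᵇ s then rows s s' j else nextRow (rows s) s j

    cone : ℕ → Fin n → Bool
    cone s j = rows s s j

    rows-stable : ∀ {s' s} j → s' ≤ s → rows s s' j ≡ cone s' j
    rows-stable {s = zero}  j z≤n = refl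
    rows-stable {s = suc s} j s'≤ with m≤n⇒m<n∨m≡n s'≤
    ... | inj₂ refl = refl
    ... | inj₁ (s≤s s'≤s) = ≡-trans (if-true (≤⇒≤ᵇ s'≤s)) (rows-stable j s'≤s)

    cone-unfold : ∀ s j → cone (suc s) j ≡ nextRow (rows s) s j
    cone-unfold s j = if-false (λ s+1≤s → <-irrefl refl (≤ᵇ⇒≤ (suc s) s s+1≤s))

    data Enters (s : ℕ) (j : Fin n) : Set where
      at-origin : T (origin j (suc s)) → Enters s j
      persists  : T (cone s j) → Enters s j
      fed       : ∀ j' s' → s' ≤ s → T (cone s' j') → edge j' j ≡ true →
                  arrival P E j' j s' ≡ suc s → Enters s j

    enter : ∀ {s j} → Enters s j → T (cone (suc s) j)
    enter {s} {j} entry = subst T (sym (cone-unfold s j)) (by entry)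
      where
      by : Enters s j → T (nextRow (rows s) s j)
      by (at-origin o) = from T-∨ (inj₁ o)
      by (persists c)  = from (T-∨ {origin j (suc s)}) (inj₂ (from T-∨ (inj₁ c)))
      by (fed j' s' s'≤s c e arr) = from (T-∨ {origin j (suc s)}) (inj₂ (from (T-∨ {rows s s j}) (inj₂ fed-j)))
        where
        feeding : T (feeds (rows s) j (suc s) j' s')
        feeding = from T-∧ (subst T (sym (rows-stable j' s'≤s)) c , from T-∧ (from T-≡ e , ≡⇒≡ᵇ _ _ arr))

        fed-j : T (fedBy (rows s) s j)
        fed-j = any⁺ (λ j'' → any (feeds (rows s) j (suc s) j'') (upTo (suc s)))
                     (lose (∈-allFin j') (any⁺ (feeds (rows s) j (suc s) j') (lose (∈-upTo⁺ (s≤s s'≤s)) feeding)))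

    entered : ∀ {s j} → T (cone (suc s) j) → Enters s j
    entered {s} {j} c with to T-∨ (subst T (cone-unfold s j) c)
    ... | inj₁ o = at-origin o
    ... | inj₂ c' with to T-∨ c'
    ...   | inj₁ c'' = persists c''
    ...   | inj₂ f =
      let j' , fj'         = satisfied (any⁻ _ (allFin n) f)
          s' , s'∈ , fs'   = find (any⁻ _ (upTo (suc s)) fj')
          s'≤s             = ≤-pred (∈-upTo⁻ s'∈)
          marked , e∧arr   = to T-∧ fs'
          e , arr          = to T-∧ e∧arr
      in fed j' s' s'≤s (subst T (rows-stable j' s'≤s) marked) (to T-≡ e) (≡ᵇ⇒≡ _ _ arr)

    origin-in-cone : ∀ {s j} → T (origin j s) → T (cone s j)
    origin-in-cone {zero}  o = o
    origin-in-cone {suc s} o = enter (at-origin o)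

    apex-in-cone : T (cone t i0)
    apex-in-cone = origin-in-cone apex-is-origin
      where
      apex-is-origin : T (origin i0 t)
      apex-is-origin with i0 ≟-Fin i0
      ... | yes _   = ≤⇒≤ᵇ (≤-refl {t})
      ... | no i0≢i0 = ⊥-elim (i0≢i0 refl)

    cone-mono : ∀ {s s' j} → s ≤ s' → T (cone s j) → T (cone s' j)
    cone-mono s≤s' = go (≤⇒≤′ s≤s')
      where
      go : ∀ {s s' j} → s ≤′ s' → T (cone s j) → T (cone s' j)
      go ≤′-refl                      c = c
      go {s' = suc s'} (≤′-step s≤′s') c = enter {s'} (persists (go s≤′s' c))

    cone-arrival : ∀ {j' j s} → T (cone s j') → edge j' j ≡ true → T (cone (arrival P E j' j s) j)
    cone-arrival {j'} {j} {s} c e = arriving _ refl (arrival-later P E e)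
      where
      arriving : ∀ a → arrival P E j' j s ≡ a → s < a → T (cone a j)
      arriving (suc a) arr (s≤s s≤a) = enter (fed j' s s≤a c e arr)

    origin-syn : ∀ {s j} → T (origin j s) → Syn P E (i0 , t) (j , s)
    origin-syn {s} {j} o with j ≟-Fin i0
    ... | yes refl = loc (≤ᵇ⇒≤ t s o)

    cone-sound : ∀ {s j} → Acc _<_ s → T (cone s j) → Syn P E (i0 , t) (j , s)
    cone-sound {zero}  _           c = origin-syn c
    cone-sound {suc s} (acc below) c with entered c
    ... | at-origin o = origin-syn o
    ... | persists c' = trans (cone-sound (below (n<1+n s)) c') (loc (n≤1+n s))
    ... | fed j' s' s'≤s c' e arr =
      trans (cone-sound (below (s≤s s'≤s)) c') (subst (λ a → Syn P E (j' , s') (_ , a)) arr (arrival-syn P E e))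

    delayed : Env
    delayed = record
      { ext      = λ j s → if cone s j then [] else ext E j s
      ; delay    = λ j i s → if cone s j then bound j i else delay E j i s
      ; delay-ok = delayed-ok
      }
      where
      delayed-ok : ∀ j i s → edge j i ≡ true →
        (1 ≤ (if cone s j then bound j i else delay E j i s)) ×
        ((if cone s j then bound j i else delay E j i s) ≤ bound j i)
      delayed-ok j i s e with cone s j
      ... | true  = bound≥1 j i e , ≤-refl
      ... | false = delay-ok E j i s e

    original-misses : ∀ {j i s s' t'} → s' ≤ s → T (cone s' j) → edge j i ≡ true → ¬ T (cone t' i) →
                      MissesAt P E (hist P E s) j i t' s'
    original-misses {j} {i} {s} {s'} s'≤s c e outside {m} sent arr =
      outside (subst (λ a → T (cone a i)) (≡-trans (arrival-sent P E sent-now) arr) (cone-arrival c e))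
      where
      sent-now : proj₁ (out P E j s') i ≡ just m
      sent-now = subst (λ H → proj₁ (P j H) i ≡ just m) (hist-prefix P E j s'≤s) sent

    -- In the delayed run, a send from the cone arrives at the deadline,
    -- which still lies in the cone.
    delayed-misses : ∀ {j i s s' t'} → T (cone s' j) → edge j i ≡ true → ¬ T (cone t' i) →
                     MissesAt P delayed (hist P delayed s) j i t' s'
    delayed-misses {j} {i} {s' = s'} c e outside _ arr =
      outside (subst (λ a → T (cone a i)) (≡-trans (cong (s' +_) (sym (if-true c))) arr)
                 (cone-mono (arrival-bounded P E {j} {i} {s'} e) (cone-arrival c e)))

    agree-outside : ∀ {s i} → Acc _<_ s → ¬ T (cone s i) → hist P delayed s i ≡ hist P E s i
    agree-outside {zero}      _           outside = cong (λ x → (x , []) ∷ []) (if-false outside)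
    agree-outside {suc s} {i} (acc below) outside =
      cong₂ _++_ (agree-outside (below (n<1+n s)) outside-before)
                 (cong₂ (λ x r → (x , r) ∷ []) (if-false outside) (recv-cong P delayed E _ _ (suc s) i alike))
      where
      outside-before : ¬ T (cone s i)
      outside-before c = outside (enter {s} (persists c))

      alike : ∀ j s' → s' < suc s → edge j i ≡ true →
              SendsAlike P delayed E (hist P delayed s) (hist P E s) j i (suc s) s'
      alike j s' (s≤s s'≤s) e with T? (cone s' j)
      ... | yes c = missed (delayed-misses {s = s} c e outside) (original-misses s'≤s c e outside)
      ... | no  c = same (cong (s' +_) (if-false c)) (cong (λ H → proj₁ (P j H) i) same-past)
        where
        open ≡-Reasoning
        same-past : take (suc s') (hist P delayed s j) ≡ take (suc s') (hist P E s j)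
        same-past = begin
          take (suc s') (hist P delayed s j) ≡⟨ hist-prefix P delayed j s'≤s ⟩
          hist P delayed s' j                 ≡⟨ agree-outside (below (s≤s s'≤s)) c ⟩
          hist P E s' j                       ≡⟨ hist-prefix P E j s'≤s ⟨
          take (suc s') (hist P E s j)        ∎

    performs-outside : ∀ {i a s} → ¬ T (cone s i) → Performs P E (i , a) s → Performs P delayed (i , a) s
    performs-outside {i} {a} {s} outside =
      subst (λ H → a ∈ proj₂ (P i H)) (sym (agree-outside (<-wellFounded s) outside))

    -- If the trigger occurs at the apex and only once in E, it never occurs
    -- in the delayed run: inside the cone inputs are suppressed, and outside
    -- it the trigger would occur at a time other than t.
    no-trigger : ∀ {e} → AtMostOnce E (i0 , e) → Occurs E (i0 , e) t → ∀ t' → ¬ Occurs delayed (i0 , e) t'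
    no-trigger {e} once occ t' occ' with T? (cone t' i0)
    ... | yes c with subst (e ∈_) (if-true c) occ'
    ...   | ()
    no-trigger {e} once occ t' occ' | no c =
      c (subst (λ s → T (cone s i0)) (once t t' occ (subst (e ∈_) (if-false c) occ')) apex-in-cone)

    -- If P solves OR, every response to the (single) trigger at the apex is
    -- performed inside the cone: otherwise it would also be performed in the
    -- delayed run, in which the trigger does not occur.
    responses-in-cone : ∀ {e k α} → SolvesOR P (i0 , e) k α → AtMostOnce E (i0 , e) → Occurs E (i0 , e) t →
                        ∀ h th → Performs P E (α h) th → T (cone th (proj₁ (α h)))
    responses-in-cone {α = α} solves once occ h th performs with T? (cone th (proj₁ (α h)))
    ... | yes inside  = inside
    ... | no  outside =
      let never            = no-trigger once occ
          only-if-trigger  = proj₁ (solves delayed (λ t₁ _ o₁ _ → ⊥-elim (never t₁ o₁)))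
          t′ , occurs-at-t′ = only-if-trigger h th (performs-outside {s = th} outside performs)
      in ⊥-elim (never t′ occurs-at-t′)

mainTheorem2 : (S : System) → let open Model S in
    (P : Protocol) (i0 : Fin n) (e : Ext) (k : ℕ) (α : Fin k → Fin n × Act) →
    SolvesOR P (i0 , e) k α →
    (E : Env) → AtMostOnce E (i0 , e) →
    (t : ℕ) (h : Fin k) (th : ℕ) →
    Occurs E (i0 , e) t → Performs P E (α h) th →
    Syn P E (i0 , t) (proj₁ (α h) , th)
mainTheorem2 S P i0 e k α solves E once t h th occurs performs =
  cone-sound (<-wellFounded th) (responses-in-cone solves once occurs h th performs)
  where open Causality.Cone S P E i0 t
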